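{- Let $G=(V,E)$ be a directed graph with positive real edge weights. The number of locally shortest path tuples (LSTs) in $G$ is $O(m^*\cdot\nu^*)$.
   Context: $d(a,b)$ denotes the shortest path distance from $a$ to $b$. A path is a locally shortest path (LSP) if every proper subpath of it is a shortest path. For vertices $x,a,b,y$ with $(x,a),(b,y)\in E$, the tuple $(xa,by)$ represents the set of LSPs of the form $x\to a\leadsto b\to y$, i.e. from $x$ to $y$ with first edge $(x,a)$ and last edge $(b,y)$ (each of weight $w(x,a)+d(a,b)+w(b,y)$); the tuple is an LST if it represents at least one LSP. $m^*$ is the number of edges of $G$ lying on some shortest path, and $\nu^*$ is the maximum, over all vertices $v$, of the number of edges lying on shortest paths through $v$. -}

module Defs where

open import Level using (0ℓ)
open import Data.Nat using (ℕ; _⊔_)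
open import Data.Fin using (Fin)
open import Data.List using (List; []; _∷_; _++_; [_]; map; foldr; length; allFin)
open import Data.List.Membership.Propositional using (_∈_)
open import Data.List.Relation.Unary.Unique.Propositional using (Unique)
open import Data.Product using (Σ; ∃; ∃-syntax; _×_; _,_)
open import Data.Sum using (_⊎_)
open import Relation.Binary.PropositionalEquality using (_≡_; _≢_)
open import Function.Bundles using (_⇔_)

-- Weights: a totally ordered abelian group (with propositional equality).
-- The real numbers (ℝ, 0, +, -, ≤) are a model; we quantify over all such
-- structures since agda-stdlib has no real numbers.
record OrderedAbelianGroup : Set₁ where
  infixl 6 _+_
  infix 4 _≤_
  field
    Carrier : Set
    0#      : Carrier
    _+_     : Carrier → Carrier → Carrier
    -_      : Carrier → Carrier
    +-assoc    : ∀ x y z → (x + y) + z ≡ x + (y + z)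
    +-comm     : ∀ x y → x + y ≡ y + x
    +-identityˡ : ∀ x → 0# + x ≡ x
    -‿inverseˡ : ∀ x → (- x) + x ≡ 0#
    _≤_      : Carrier → Carrier → Set
    ≤-refl   : ∀ {x} → x ≤ x
    ≤-trans  : ∀ {x y z} → x ≤ y → y ≤ z → x ≤ z
    ≤-antisym : ∀ {x y} → x ≤ y → y ≤ x → x ≡ y
    ≤-total  : ∀ x y → x ≤ y ⊎ y ≤ x
    +-monoˡ-≤ : ∀ {x y} z → x ≤ y → x + z ≤ y + z

  _<_ : Carrier → Carrier → Set
  x < y = x ≤ y × x ≢ y

-- A directed graph on vertex set Fin n with edge relation E and
-- weight function w (only the values on edges matter).
module Graph (W : OrderedAbelianGroup) {n : ℕ}
             (E : Fin n → Fin n → Set)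
             (w : Fin n → Fin n → OrderedAbelianGroup.Carrier W) where
  open OrderedAbelianGroup W

  V : Set
  V = Fin n

  PositiveWeights : Set
  PositiveWeights = ∀ u v → E u v → 0# < w u v

  data IsPath : V → V → List V → Set where
    single : ∀ {v} → IsPath v v (v ∷ [])
    cons   : ∀ {u v t L} → E u v → IsPath v t (v ∷ L) → IsPath u t (u ∷ v ∷ L)

  wt : List V → Carrier
  wt []            = 0#
  wt (u ∷ [])      = 0#
  wt (u ∷ v ∷ L)   = w u v + wt (v ∷ L)

  Shortest : V → V → List V → Set
  Shortest s t L = IsPath s t L × (∀ L' → IsPath s t L' → wt L ≤ wt L')

  ProperSubpath : List V → List V → Set
  ProperSubpath q L =
    ∃[ pre ] ∃[ suf ] (L ≡ pre ++ q ++ suf × q ≢ [] × (pre ≢ [] ⊎ suf ≢ []))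

  LSP : V → V → List V → Set
  LSP s t L = IsPath s t L × (∀ q → ProperSubpath q L → ∃[ a ] ∃[ b ] Shortest a b q)

  LST : V × V × V × V → Set
  LST (x , a , b , y) =
    E x a × E b y × ∃[ Q ] (IsPath a b Q × LSP x y (x ∷ Q ++ [ y ]))

  EdgeIn : V × V → List V → Set
  EdgeIn (u , v) L = ∃[ pre ] ∃[ suf ] (L ≡ pre ++ u ∷ v ∷ suf)

  OnShortestPath : V × V → Set
  OnShortestPath e = ∃[ s ] ∃[ t ] ∃[ L ] (Shortest s t L × EdgeIn e L)

  OnShortestPathThrough : V → V × V → Set
  OnShortestPathThrough x e =
    ∃[ s ] ∃[ t ] ∃[ L ] (Shortest s t L × x ∈ L × EdgeIn e L)

-- L is a duplicate-free enumeration of exactly the elements satisfying P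
-- (so length L is the number of such elements)
Enumerates : {A : Set} → List A → (A → Set) → Set
Enumerates L P = Unique L × (∀ a → (a ∈ L) ⇔ P a)

-- maximum of f over Fin n (0 if n = 0)
maxFin : {n : ℕ} → (Fin n → ℕ) → ℕ
maxFin {n} f = foldr _⊔_ 0 (map f (allFin n))

module Submission where

-- Send an LST (xa, by) to the pair of its first edge (x,a) and
-- its last edge (b,y).  In an LSP  x → a ⇝ b → y  every proper subpath is a
-- shortest path, so
--   * the prefix  x → a ⇝ b  is a shortest path containing (x,a): the first
--     edge is one of the m* edges on shortest paths;
--   * the suffix  a ⇝ b → y  is a shortest path through a containing (b,y):
--     the last edge is one of the at most ν* edges on shortest paths through a.
-- Hence every LST occurs in the list of tuples (x,a,b,y) built from a first
-- edge (x,a) ∈ Ms and a last edge (b,y) ∈ Ns a, which has length at most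
-- m* · ν*; by pigeonhole the number of distinct LSTs is at most m* · ν*
-- (so C = 1).

open import Defs
open import Data.Nat using (ℕ; _+_; _*_; _≤_; _⊔_; suc; z≤n; s≤s)
open import Data.Nat.Properties using (m≤m⊔n; m≤n⊔m; ≤-trans; ≤-reflexive; +-mono-≤; *-identityˡ; module ≤-Reasoning)
open import Data.Fin using (Fin)
open import Data.List using (List; length; []; _∷_; _++_; [_]; map; foldr; allFin)
open import Data.List.Properties using (length-++; length-map; ++-assoc; ++-identityʳ)
open import Data.List.Relation.Unary.All using (All; lookup)
open import Data.List.Relation.Unary.Any using (here; there)
open import Data.List.Relation.Unary.AllPairs using ([]; _∷_)
open import Data.List.Relation.Unary.Unique.Propositional using (Unique)
open import Data.List.Membership.Propositional using (_∈_)
open import Data.List.Membership.Propositional.Properties using (∈-++⁺ˡ; ∈-++⁺ʳ; ∈-map⁺; ∈-allFin)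
open import Data.Product using (∃-syntax; _×_; _,_; proj₂)
open import Data.Sum using (inj₁; inj₂)
open import Data.Empty using (⊥-elim)
open import Function.Bundles using (Equivalence)
open import Relation.Binary.PropositionalEquality using (_≡_; refl; sym; trans; cong; _≢_)

module _ {A : Set} where

  remove : ∀ {x : A} {ys} → x ∈ ys → List A
  remove {ys = _ ∷ ys} (here _)  = ys
  remove {ys = y ∷ ys} (there p) = y ∷ remove p

  length-remove : ∀ {x : A} {ys} (p : x ∈ ys) → length ys ≡ suc (length (remove p))
  length-remove (here _)              = refl
  length-remove {ys = _ ∷ _} (there p) = cong suc (length-remove p)

  ∈-remove : ∀ {x y : A} {ys} → y ∈ ys → y ≢ x → (p : x ∈ ys) → y ∈ remove p
  ∈-remove (here refl) y≢x (here refl) = ⊥-elim (y≢x refl)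
  ∈-remove (there q)   y≢x (here refl) = q
  ∈-remove (here refl) y≢x (there p)   = here refl
  ∈-remove (there q)   y≢x (there p)   = there (∈-remove q y≢x p)

  unique-⊆-length : ∀ (xs ys : List A) → Unique xs →
                    (∀ {z} → z ∈ xs → z ∈ ys) → length xs ≤ length ys
  unique-⊆-length []       ys _          _   = z≤n
  unique-⊆-length (x ∷ xs) ys (x∉xs ∷ u) xs⊆ys = begin
    suc (length xs)            ≤⟨ s≤s (unique-⊆-length xs (remove x∈ys) u xs⊆rest) ⟩
    suc (length (remove x∈ys)) ≡⟨ sym (length-remove x∈ys) ⟩
    length ys                  ∎
    where
    open ≤-Reasoning
    x∈ys : x ∈ ys
    x∈ys = xs⊆ys (here refl)
    xs⊆rest : ∀ {z} → z ∈ xs → z ∈ remove x∈ys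
    xs⊆rest z∈xs = ∈-remove (xs⊆ys (there z∈xs)) (λ z≡x → lookup x∉xs z∈xs (sym z≡x)) x∈ys

module _ {A B C : Set} (f : A → B → C) (g : A → List B) where

  dependentPairs : List A → List C
  dependentPairs []       = []
  dependentPairs (a ∷ as) = map (f a) (g a) ++ dependentPairs as

  length-dependentPairs : ∀ {K} → (∀ a → length (g a) ≤ K) →
                          ∀ as → length (dependentPairs as) ≤ length as * K
  length-dependentPairs g≤K []       = z≤n
  length-dependentPairs {K} g≤K (a ∷ as) = begin
    length (map (f a) (g a) ++ dependentPairs as)
      ≡⟨ length-++ (map (f a) (g a)) ⟩
    length (map (f a) (g a)) + length (dependentPairs as)
      ≤⟨ +-mono-≤ (≤-trans (≤-reflexive (length-map (f a) (g a))) (g≤K a))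
                  (length-dependentPairs g≤K as) ⟩
    K + length as * K
      ∎
    where open ≤-Reasoning

  ∈-dependentPairs : ∀ {a b} as → a ∈ as → b ∈ g a → f a b ∈ dependentPairs as
  ∈-dependentPairs (a ∷ as) (here refl) b∈ga = ∈-++⁺ˡ (∈-map⁺ (f a) b∈ga)
  ∈-dependentPairs (a ∷ as) (there a∈as) b∈ga = ∈-++⁺ʳ _ (∈-dependentPairs as a∈as b∈ga)

≤-maxFin : ∀ {n} (f : Fin n → ℕ) (i : Fin n) → f i ≤ maxFin f
≤-maxFin {n} f i = ≤-foldr-⊔ (map f (allFin n)) (∈-map⁺ f (∈-allFin i))
  where
  ≤-foldr-⊔ : ∀ {x} (l : List ℕ) → x ∈ l → x ≤ foldr _⊔_ 0 l
  ≤-foldr-⊔ (y ∷ l) (here refl) = m≤m⊔n y _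
  ≤-foldr-⊔ (y ∷ l) (there p)   = ≤-trans (≤-foldr-⊔ l p) (m≤n⊔m y _)

module LSTEdges (W : OrderedAbelianGroup) {n : ℕ}
                (E : Fin n → Fin n → Set)
                (w : Fin n → Fin n → OrderedAbelianGroup.Carrier W) where
  open Graph W E w

  path-starts : ∀ {s t L} → IsPath s t L → ∃[ L' ] (L ≡ s ∷ L')
  path-starts single     = _ , refl
  path-starts (cons _ _) = _ , refl

  path-ends : ∀ {s t L} → IsPath s t L → ∃[ L₀ ] (L ≡ L₀ ++ [ t ])
  path-ends single = [] , refl
  path-ends {s = u} (cons _ p) with path-ends p
  ... | L₀ , eq = u ∷ L₀ , cong (u ∷_) eq

  -- The first edge of an LST lies on a shortest path, namely the prefix
  -- x → a ⇝ b, a proper subpath of the LSP.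
  first-edge-on-shortest : ∀ {x a b y} → LST (x , a , b , y) → OnShortestPath (x , a)
  first-edge-on-shortest {x} {a} {b} {y} (_ , _ , Q , a⇝b , _ , subpathsShortest)
    with path-starts a⇝b
  ... | Q' , refl with subpathsShortest (x ∷ a ∷ Q') ([] , [ y ] , refl , (λ ()) , inj₂ (λ ()))
  ... | s , t , shortest = s , t , x ∷ a ∷ Q' , shortest , [] , Q' , refl

  -- The last edge of an LST lies on a shortest path through a, namely the
  -- suffix a ⇝ b → y, a proper subpath of the LSP.
  last-edge-on-shortest-through : ∀ {x a b y} → LST (x , a , b , y) →
                                  OnShortestPathThrough a (b , y)
  last-edge-on-shortest-through {x} {a} {b} {y} (_ , _ , Q , a⇝b , _ , subpathsShortest)
    with path-starts a⇝b | path-ends a⇝b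
  ... | Q' , refl | Q₀ , Q≡Q₀b
    with subpathsShortest (a ∷ Q' ++ [ y ])
           ([ x ] , [] , cong (x ∷_) (sym (++-identityʳ (a ∷ Q' ++ [ y ]))) , (λ ()) , inj₁ (λ ()))
  ... | s , t , shortest = s , t , a ∷ Q' ++ [ y ] , shortest , here refl , Q₀ , [] , ends-with-by
    where
    ends-with-by : a ∷ Q' ++ [ y ] ≡ Q₀ ++ b ∷ y ∷ []
    ends-with-by = trans (cong (_++ [ y ]) Q≡Q₀b) (++-assoc Q₀ [ b ] [ y ])

lemma1 : ∃[ C ] ((W : OrderedAbelianGroup) → (n : ℕ)
    → (E : Fin n → Fin n → Set)
    → (w : Fin n → Fin n → OrderedAbelianGroup.Carrier W)
    → Graph.PositiveWeights W E w
    → (Ts : List (Fin n × Fin n × Fin n × Fin n))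
    → Unique Ts → All (Graph.LST W E w) Ts
    → (Ms : List (Fin n × Fin n))
    → Enumerates Ms (Graph.OnShortestPath W E w)
    → (Ns : Fin n → List (Fin n × Fin n))
    → ((v : Fin n) → Enumerates (Ns v) (Graph.OnShortestPathThrough W E w v))
    → length Ts ≤ C * length Ms * maxFin (λ v → length (Ns v)))
lemma1 = 1 , λ W n E w _ Ts uniqueTs allLST Ms (_ , enumMs) Ns enumNs →
  let open LSTEdges W E w
      open ≤-Reasoning
      ν* = maxFin (λ v → length (Ns v))
      tuple : Fin n × Fin n → Fin n × Fin n → Fin n × Fin n × Fin n × Fin n
      tuple (x , a) (b , y) = x , a , b , y
      lastEdges : Fin n × Fin n → List (Fin n × Fin n)
      lastEdges (x , a) = Ns a
      candidates = dependentPairs tuple lastEdges Ms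
      Ts⊆candidates : ∀ {T} → T ∈ Ts → T ∈ candidates
      Ts⊆candidates {x , a , b , y} T∈Ts =
        let lst = lookup allLST T∈Ts in
        ∈-dependentPairs tuple lastEdges Ms
          (Equivalence.from (enumMs (x , a)) (first-edge-on-shortest lst))
          (Equivalence.from (proj₂ (enumNs a) (b , y)) (last-edge-on-shortest-through lst))
  in begin
    length Ts           ≤⟨ unique-⊆-length Ts candidates uniqueTs Ts⊆candidates ⟩
    length candidates   ≤⟨ length-dependentPairs tuple lastEdges (λ (_ , a) → ≤-maxFin _ a) Ms ⟩
    length Ms * ν*      ≡⟨ cong (_* ν*) (sym (*-identityˡ (length Ms))) ⟩
    1 * length Ms * ν*  ∎
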